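{- Let $G=(K\uplus S,E)$ be a split graph such that every sequence of token-slides in $G$ (starting from a D$2$DS) is a $\mathsf{TS}$-sequence, i.e., every time a token is slid along an edge to an unoccupied vertex the resulting set is a D$2$DS of $G$. Then for any two D$2$DSs $D_s,D_t$ of $G$ of the same size, there exists a $\mathsf{TS}$-sequence between $D_s$ and $D_t$ of length exactly $M^\star_{\mathsf{TS}}(G,D_s,D_t)$.
   Context: Graphs are finite, simple, undirected and connected. A split graph $G=(K\uplus S,E)$ has vertex set partitioned into a clique $K$ and an independent set $S$. A D$2$DS of $G$ is a set $D\subseteq V(G)$ such that every vertex is at distance at most $2$ from some vertex of $D$. A $\mathsf{TS}$-sequence between D$2$DSs $D_s,D_t$ is a sequence $D_s=D_0,\dots,D_q=D_t$ of D$2$DSs with $D_i\setminus D_{i+1}=\{x_i\}$, $D_{i+1}\setminus D_i=\{y_i\}$ and $x_iy_i\in E(G)$ for each $i$; its length is $q$. With $D_s=\{s_1,\dots,s_k\}$, $M^\star_{\mathsf{TS}}(G,D_s,D_t)=\min_f\sum_{i=1}^k\mathrm{dist}_G(s_i,f(s_i))$ over all bijections $f:D_s\to D_t$. -}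

module Defs where

open import Data.Nat using (ℕ; zero; suc; _≤_)
open import Data.Bool using (Bool; true; false; _∧_; _∨_; if_then_else_; not)
open import Data.Fin using (Fin)
open import Data.Fin.Properties using (_≟_)
open import Data.Fin.Subset using (Subset; _∈_; _∉_; ∣_∣; inside; outside)
open import Data.Vec using (lookup; _[_]≔_)
open import Data.List using (map; allFin)
open import Data.Bool.ListAction using (any)
open import Data.Nat.ListAction using (sum)
open import Data.Sum using (_⊎_)
open import Data.Product using (Σ; ∃; _×_)
open import Relation.Nullary.Decidable using (⌊_⌋)
open import Relation.Binary.PropositionalEquality using (_≡_)

record Graph : Set where
  field
    n      : ℕ
    adj    : Fin n → Fin n → Bool
    sym    : ∀ u v → adj u v ≡ adj v u
    irrefl : ∀ v → adj v v ≡ false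

open Graph public

module _ (G : Graph) where

  reach : ℕ → Fin (n G) → Fin (n G) → Bool
  reach zero    u v = ⌊ u ≟ v ⌋
  reach (suc k) u v = reach k u v ∨ any (λ w → reach k u w ∧ adj G w v) (allFin (n G))

  Connected : Set
  Connected = ∀ u v → ∃ λ k → reach k u v ≡ true

  IsSplit : Set
  IsSplit = Σ (Subset (n G)) λ K →
      (∀ u v → u ∈ K → v ∈ K → u ≡ v ⊎ adj G u v ≡ true)
    × (∀ u v → u ∉ K → v ∉ K → adj G u v ≡ false)

  -- dist u v = least k with a walk of length ≤ k from u to v
  -- (searching k = 0 .. n; in a connected graph the distance is < n)
  dist : Fin (n G) → Fin (n G) → ℕ
  dist u v = search (n G) 0
    where
      search : ℕ → ℕ → ℕ
      search zero    k = k
      search (suc f) k = if reach k u v then k else search f (suc k)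

  IsD2DS : Subset (n G) → Set
  IsD2DS D = ∀ v → ∃ λ d → d ∈ D × dist d v ≤ 2

  Slide : Subset (n G) → Subset (n G) → Set
  Slide D D' = ∃ λ x → ∃ λ y → x ∈ D × y ∉ D × adj G x y ≡ true
                 × D' ≡ (D [ x ]≔ outside) [ y ]≔ inside

  data TSSeq : Subset (n G) → Subset (n G) → ℕ → Set where
    done : ∀ {D} → IsD2DS D → TSSeq D D 0
    step : ∀ {D D' D'' q} → IsD2DS D → Slide D D' → TSSeq D' D'' q → TSSeq D D'' (suc q)

  BijOn : Subset (n G) → Subset (n G) → (Fin (n G) → Fin (n G)) → Set
  BijOn Ds Dt f = (∀ v → v ∈ Ds → f v ∈ Dt)
                × (∀ u v → u ∈ Ds → v ∈ Ds → f u ≡ f v → u ≡ v)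
                × (∀ w → w ∈ Dt → ∃ λ v → v ∈ Ds × f v ≡ w)

  cost : Subset (n G) → (Fin (n G) → Fin (n G)) → ℕ
  cost Ds f = sum (map (λ v → if lookup Ds v then dist v (f v) else 0) (allFin (n G)))

  IsMstar : Subset (n G) → Subset (n G) → ℕ → Set
  IsMstar Ds Dt m = (∃ λ f → BijOn Ds Dt f × cost Ds f ≡ m)
                  × (∀ f → BijOn Ds Dt f → m ≤ cost Ds f)

-- If m > 0 then Dt ⊄ Ds (otherwise equal cardinalities force Ds = Dt and
-- the identity has cost 0), so an optimal bijection f sends some token x to a vertex f x ∉ Ds.
-- Let y be the neighbour of x on a shortest path to f x.  If y is free, slide x to y and let
-- the new token at y take over f x: the cost drops by exactly one, and by the triangle
-- inequality along xy no assignment of the new set does better, so M* drops by one.  If y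
-- carries a token, exchanging the targets of x and y does not increase the cost, so it is
-- still optimal, and now y is one step closer to the unoccupied target f x.  The hypothesis
-- that every slide yields a D2DS keeps every intermediate set admissible.
{-# OPTIONS --safe #-}
module Submission where

open import Defs hiding (sym)
open import Data.Nat using (ℕ; zero; suc; _+_; _∸_; _≤_; _<_; _≤′_; ≤′-reflexive; ≤′-step; z≤n; s≤s)
open import Data.Nat.Properties
  using (m≤m+n; m≤n+m; ≤-trans; ≤-antisym; ≤-reflexive; ≤-total; ≤-pred; ≤-<-trans; ≤∧≢⇒<; ≤⇒≯;
         ≤⇒≤′; n≤0⇒n≡0; +-assoc; +-comm; +-suc; +-identityʳ; +-monoʳ-≤; +-monoˡ-≤; +-cancelʳ-≤;
         +-cancelʳ-≡; m∸n+n≡m; suc-injective; module ≤-Reasoning; +-commutativeSemigroup;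
         +-0-commutativeMonoid)
open import Algebra.Properties.CommutativeSemigroup +-commutativeSemigroup
  using (xy∙z≈xz∙y; xy∙z≈zy∙x; x∙yz≈yx∙z)
open import Data.Bool using (Bool; true; false; T; if_then_else_; _∧_)
open import Data.Bool.ListAction using (any)
open import Data.Bool.Properties using (T-≡; T-∨; T-∧)
open import Data.Fin using (Fin; zero; suc)
open import Data.Fin.Properties using (_≟_; ¬∀⟶∃¬)
import Data.Fin.Properties as Fin
open import Data.Fin.Permutation.Components using (transpose)
open import Data.Fin.Subset using (Subset; _∈_; _∉_; _⊆_; ∣_∣; inside; outside)
open import Data.Fin.Subset.Properties
  using (_∈?_; _⊆?_; ⊆-antisym; p⊂q⇒∣p∣<∣q∣; ∣p∣≤n; x∈p⇒∣p-x∣<∣p∣)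
open import Data.Vec using ([]; _∷_; lookup; _[_]≔_)
open import Data.Vec.Properties
  using ([]=⇒lookup; lookup⇒[]=; lookup∘update; lookup∘update′; lookup∘tabulate)
import Data.Vec as Vec
open import Data.Vec.Functional using (updateAt)
open import Data.Vec.Functional.Properties using (updateAt-updates; updateAt-minimal)
open import Data.List using (allFin; tabulate)
import Data.List.Properties as List using (map-tabulate)
open import Data.Nat.ListAction using () renaming (sum to sumList)
open import Data.List.Membership.Propositional using (lose)
open import Data.List.Membership.Propositional.Properties using (∈-allFin)
open import Data.List.Relation.Unary.Any using (satisfied)
open import Data.List.Relation.Unary.Any.Properties using (any⁺; any⁻)
open import Algebra.Properties.CommutativeMonoid.Sum +-0-commutativeMonoid
  using (sum; sum-cong-≗; sum-replicate-zero)
open import Data.Sum using (_⊎_; inj₁; inj₂)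
import Data.Sum
import Data.Product
open import Data.Product using (∃; _×_; _,_; proj₂)
open import Function using (_∘_; id; const; Equivalence)
open import Relation.Nullary using (¬_; Dec; yes; no; contradiction)
open import Relation.Nullary.Decidable using (toWitness; fromWitness; dec-true; dec-false; _→-dec_)
open import Relation.Binary.PropositionalEquality

open Equivalence using (to; from)

sum-tabulate : ∀ {n} (F : Fin n → ℕ) → sumList (tabulate F) ≡ sum F
sum-tabulate {zero}  F = refl
sum-tabulate {suc n} F = cong (F zero +_) (sum-tabulate (F ∘ suc))

≤-sum : ∀ {n} (F : Fin n → ℕ) a → F a ≤ sum F
≤-sum F zero    = m≤m+n (F zero) _
≤-sum F (suc a) = ≤-trans (≤-sum (F ∘ suc) a) (m≤n+m _ (F zero))

sum-update : ∀ {n} (F F′ : Fin n → ℕ) a → (∀ v → v ≢ a → F v ≡ F′ v) →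
             sum F + F′ a ≡ sum F′ + F a
sum-update F F′ zero agree = begin
  F zero + sum (F ∘ suc) + F′ zero   ≡⟨ cong (λ s → F zero + s + F′ zero)
                                             (sum-cong-≗ (λ v → agree (suc v) λ ())) ⟩
  F zero + sum (F′ ∘ suc) + F′ zero  ≡⟨ xy∙z≈zy∙x (F zero) _ (F′ zero) ⟩
  F′ zero + sum (F′ ∘ suc) + F zero  ∎
  where open ≡-Reasoning
sum-update F F′ (suc a) agree = begin
  F zero + sum (F ∘ suc) + F′ (suc a)     ≡⟨ +-assoc (F zero) _ _ ⟩
  F zero + (sum (F ∘ suc) + F′ (suc a))   ≡⟨ cong₂ _+_ (agree zero λ ())
                                                     (sum-update (F ∘ suc) (F′ ∘ suc) a
                                                       (λ v v≢a → agree (suc v) (v≢a ∘ Fin.suc-injective))) ⟩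
  F′ zero + (sum (F′ ∘ suc) + F (suc a))  ≡⟨ +-assoc (F′ zero) _ _ ⟨
  F′ zero + sum (F′ ∘ suc) + F (suc a)    ∎
  where open ≡-Reasoning

sum-update₂ : ∀ {n} (F F′ : Fin n → ℕ) {a b} → a ≢ b → (∀ v → v ≢ a → v ≢ b → F v ≡ F′ v) →
              sum F + (F′ a + F′ b) ≡ sum F′ + (F a + F b)
sum-update₂ F F′ {a} {b} a≢b agree = begin
  sum F + (F′ a + F′ b)  ≡⟨ +-assoc (sum F) _ _ ⟨
  sum F + F′ a + F′ b    ≡⟨ cong (λ c → sum F + c + F′ b) (updateAt-updates a F) ⟨
  sum F + F₁ a + F′ b    ≡⟨ cong (_+ F′ b)
                                 (sum-update F F₁ a (λ v v≢a → sym (updateAt-minimal v a F v≢a))) ⟩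
  sum F₁ + F a + F′ b    ≡⟨ xy∙z≈xz∙y (sum F₁) _ _ ⟩
  sum F₁ + F′ b + F a    ≡⟨ cong (_+ F a) (sum-update F₁ F′ b F₁≡F′-off-b) ⟩
  sum F′ + F₁ b + F a    ≡⟨ cong (λ c → sum F′ + c + F a) (updateAt-minimal b a F (a≢b ∘ sym)) ⟩
  sum F′ + F b + F a     ≡⟨ xy∙z≈xz∙y (sum F′) _ _ ⟩
  sum F′ + F a + F b     ≡⟨ +-assoc (sum F′) _ _ ⟩
  sum F′ + (F a + F b)   ∎
  where
  open ≡-Reasoning
  F₁ = updateAt F a (const (F′ a))
  F₁≡F′-off-b : ∀ v → v ≢ b → F₁ v ≡ F′ v
  F₁≡F′-off-b v v≢b with v ≟ a
  ... | yes refl = updateAt-updates a F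
  ... | no v≢a   = trans (updateAt-minimal v a F v≢a) (agree v v≢a v≢b)

≤-by-exchange : ∀ {a b s t} k → a + s ≡ b + t → s ≤ k + t → b ≤ k + a
≤-by-exchange {a} {b} {s} {t} k a+s≡b+t s≤k+t = +-cancelʳ-≤ t b (k + a) (begin
  b + t        ≡⟨ a+s≡b+t ⟨
  a + s        ≤⟨ +-monoʳ-≤ a s≤k+t ⟩
  a + (k + t)  ≡⟨ x∙yz≈yx∙z a k t ⟩
  k + a + t    ∎)
  where open ≤-Reasoning

module _ {n : ℕ} where

  ∉⇒lookup≡outside : ∀ {x} {p : Subset n} → x ∉ p → lookup p x ≡ outside
  ∉⇒lookup≡outside {x} {p} x∉p with lookup p x in eq
  ... | true  = contradiction (lookup⇒[]= x p eq) x∉p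
  ... | false = refl

  lookup≡outside⇒∉ : ∀ {x} {p : Subset n} → lookup p x ≡ outside → x ∉ p
  lookup≡outside⇒∉ eq x∈p with trans (sym eq) ([]=⇒lookup x∈p)
  ... | ()

  ∈-resp-lookup : ∀ {x} {p q : Subset n} → lookup p x ≡ lookup q x → x ∈ p → x ∈ q
  ∈-resp-lookup {x} {p} {q} eq x∈p = lookup⇒[]= x q (trans (sym eq) ([]=⇒lookup x∈p))

  ¬⊆⇒∃∈∉ : ∀ {p q : Subset n} → ¬ p ⊆ q → ∃ λ x → x ∈ p × x ∉ q
  ¬⊆⇒∃∈∉ {p} {q} p⊈q
    with ¬∀⟶∃¬ n (λ x → x ∈ p → x ∈ q) (λ x → x ∈? p →-dec x ∈? q) (λ p⊆q → p⊈q (p⊆q _))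
  ... | x , ¬[x∈p⇒x∈q] with x ∈? p
  ...   | yes x∈p = x , x∈p , ¬[x∈p⇒x∈q] ∘ const
  ...   | no  x∉p = contradiction (λ x∈p → contradiction x∈p x∉p) ¬[x∈p⇒x∈q]

  ⊆∧∣≥∣⇒≡ : ∀ {p q : Subset n} → p ⊆ q → ∣ q ∣ ≤ ∣ p ∣ → p ≡ q
  ⊆∧∣≥∣⇒≡ {p} {q} p⊆q ∣q∣≤∣p∣ with q ⊆? p
  ... | yes q⊆p = ⊆-antisym p⊆q q⊆p
  ... | no  q⊈p = contradiction (p⊂q⇒∣p∣<∣q∣ (p⊆q , ¬⊆⇒∃∈∉ q⊈p)) (≤⇒≯ ∣q∣≤∣p∣)

  transpose-fst : ∀ (i j : Fin n) → transpose i j i ≡ j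
  transpose-fst i j rewrite dec-true (i ≟ i) refl = refl

  transpose-snd : ∀ (i j : Fin n) → transpose i j j ≡ i
  transpose-snd i j with j ≟ i
  ... | yes refl = refl
  ... | no  _    rewrite dec-true (j ≟ j) refl = refl

  transpose-other : ∀ {i j k : Fin n} → k ≢ i → k ≢ j → transpose i j k ≡ k
  transpose-other {i} {j} {k} k≢i k≢j rewrite dec-false (k ≟ i) k≢i | dec-false (k ≟ j) k≢j = refl

  transpose-involutive : ∀ (i j k : Fin n) → transpose i j (transpose i j k) ≡ k
  transpose-involutive i j k = by-cases (k ≟ i) (k ≟ j)
    where
    by-cases : Dec (k ≡ i) → Dec (k ≡ j) → transpose i j (transpose i j k) ≡ k
    by-cases (yes refl) _          = trans (cong (transpose i j) (transpose-fst i j)) (transpose-snd i j)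
    by-cases (no _)     (yes refl) = trans (cong (transpose i j) (transpose-snd i j)) (transpose-fst i j)
    by-cases (no k≢i)   (no k≢j)   =
      trans (cong (transpose i j) (transpose-other k≢i k≢j)) (transpose-other k≢i k≢j)

  transpose-∈ : ∀ {p q : Subset n} {x y} → (x ∈ p → y ∈ q) → (y ∈ p → x ∈ q) →
                (∀ {v} → v ≢ x → v ≢ y → v ∈ p → v ∈ q) →
                ∀ {v} → v ∈ p → transpose x y v ∈ q
  transpose-∈ {p} {q} {x} {y} x↦y y↦x other {v} v∈p = by-cases (v ≟ x) (v ≟ y)
    where
    by-cases : Dec (v ≡ x) → Dec (v ≡ y) → transpose x y v ∈ q
    by-cases (yes refl) _          = subst (_∈ q) (sym (transpose-fst x y)) (x↦y v∈p)
    by-cases (no _)     (yes refl) = subst (_∈ q) (sym (transpose-snd x y)) (y↦x v∈p)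
    by-cases (no v≢x)   (no v≢y)   = subst (_∈ q) (sym (transpose-other v≢x v≢y)) (other v≢x v≢y v∈p)

  move : Subset n → Fin n → Fin n → Subset n
  move p x y = (p [ x ]≔ outside) [ y ]≔ inside

  lookup-move-target : ∀ p x y → lookup (move p x y) y ≡ inside
  lookup-move-target p x y = lookup∘update y (p [ x ]≔ outside) inside

  lookup-move-source : ∀ p {x y} → x ≢ y → lookup (move p x y) x ≡ outside
  lookup-move-source p {x} x≢y =
    trans (lookup∘update′ x≢y (p [ x ]≔ outside) inside) (lookup∘update x p outside)

  lookup-move-other : ∀ p {x y v} → v ≢ x → v ≢ y → lookup (move p x y) v ≡ lookup p v
  lookup-move-other p {x} v≢x v≢y =
    trans (lookup∘update′ v≢y (p [ x ]≔ outside) inside) (lookup∘update′ v≢x p outside)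

  ∈∧∉⇒≢ : ∀ {x y} {p : Subset n} → x ∈ p → y ∉ p → x ≢ y
  ∈∧∉⇒≢ x∈p y∉p refl = y∉p x∈p

  ∈-move-target : ∀ p x y → y ∈ move p x y
  ∈-move-target p x y = lookup⇒[]= y (move p x y) (lookup-move-target p x y)

  ∉-move-source : ∀ p {x y} → x ≢ y → x ∉ move p x y
  ∉-move-source p x≢y = lookup≡outside⇒∉ (lookup-move-source p x≢y)

  transpose-∈-move : ∀ {p x y} → x ∈ p → y ∉ p → ∀ {v} → v ∈ p → transpose x y v ∈ move p x y
  transpose-∈-move {p} {x} {y} x∈p y∉p =
    transpose-∈ (const (∈-move-target p x y)) (λ y∈p → contradiction y∈p y∉p)
                (λ v≢x v≢y → ∈-resp-lookup (sym (lookup-move-other p v≢x v≢y)))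

  transpose-∈-unmove : ∀ {p x y} → x ∈ p → y ∉ p → ∀ {v} → v ∈ move p x y → transpose x y v ∈ p
  transpose-∈-unmove {p} {x} {y} x∈p y∉p =
    transpose-∈ (λ x∈p′ → contradiction x∈p′ (∉-move-source p (∈∧∉⇒≢ x∈p y∉p))) (const x∈p)
                (λ v≢x v≢y → ∈-resp-lookup (lookup-move-other p v≢x v≢y))

indicator : Bool → ℕ
indicator b = if b then 1 else 0

∣p∣≡sum : ∀ {n} (p : Subset n) → ∣ p ∣ ≡ sum (indicator ∘ lookup p)
∣p∣≡sum []          = refl
∣p∣≡sum (true ∷ p)  = cong suc (∣p∣≡sum p)
∣p∣≡sum (false ∷ p) = ∣p∣≡sum p

∣move∣ : ∀ {n} {p : Subset n} {x y} → x ∈ p → y ∉ p → ∣ move p x y ∣ ≡ ∣ p ∣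
∣move∣ {p = p} {x} {y} x∈p y∉p = +-cancelʳ-≡ 1 _ _ (begin
  ∣ p′ ∣ + 1                     ≡⟨ cong (_+ 1) (∣p∣≡sum p′) ⟩
  sum (χ p′) + 1                 ≡⟨ cong₂ (λ b c → sum (χ p′) + (indicator b + indicator c))
                                          ([]=⇒lookup x∈p) (∉⇒lookup≡outside y∉p) ⟨
  sum (χ p′) + (χ p x + χ p y)   ≡⟨ sum-update₂ (χ p) (χ p′) (∈∧∉⇒≢ x∈p y∉p)
                                          (λ v v≢x v≢y → cong indicator (sym (lookup-move-other p v≢x v≢y))) ⟨
  sum (χ p) + (χ p′ x + χ p′ y)  ≡⟨ cong₂ (λ b c → sum (χ p) + (indicator b + indicator c))
                                          (lookup-move-source p (∈∧∉⇒≢ x∈p y∉p)) (lookup-move-target p x y) ⟩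
  sum (χ p) + 1                  ≡⟨ cong (_+ 1) (∣p∣≡sum p) ⟨
  ∣ p ∣ + 1                      ∎)
  where
  open ≡-Reasoning
  p′ = move p x y
  χ : Subset _ → Fin _ → ℕ
  χ q = indicator ∘ lookup q

-- Defs.dist runs a local search function that cannot be named from outside.  The
-- metavariable dist-search is solved by unifying it with that function in the
-- (trivially true) equation below, after which dist G u v unfolds definitionally
-- to dist-search G u v (n G) 0.
mutual
  dist-search : (G : Graph) → Fin (n G) → Fin (n G) → ℕ → ℕ → ℕ
  dist-search = _

  dist-search-unifier : (G : Graph) (u v : Fin (n G)) → dist G u v ≡ dist G u v
  dist-search-unifier record { n = suc N ; adj = a ; sym = s ; irrefl = i } u v with suc N | 1
  ... | m | k = cong (if reach G 0 u v then 0 else_) (refl {x = dist-search G u v N k})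
    where G = record { n = m ; adj = a ; sym = s ; irrefl = i }

module _ (G : Graph) where

  private
    V = Fin (n G)

  Adj : V → V → Set
  Adj u v = T (adj G u v)

  -- A record rather than T (reach G k u v), so that k, u and v can be inferred from it.
  record Reach (k : ℕ) (u v : V) : Set where
    constructor reached
    field walk : T (reach G k u v)

  open Reach

  adj⇒≢ : ∀ {x y} → Adj x y → x ≢ y
  adj⇒≢ {x} a refl = subst T (irrefl G x) a

  reach-zero⇒≡ : ∀ {u v} → Reach 0 u v → u ≡ v
  reach-zero⇒≡ r = toWitness (walk r)

  reach-zero-refl : ∀ {u} → Reach 0 u u
  reach-zero-refl = reached (fromWitness refl)

  reach-suc : ∀ {k u v} → Reach k u v → Reach (suc k) u v
  reach-suc r = reached (from T-∨ (inj₁ (walk r)))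

  reach-extend : ∀ {k u w v} → Reach k u w → Adj w v → Reach (suc k) u v
  reach-extend {w = w} r a = reached (from T-∨ (inj₂ (any⁺ _ (lose (∈-allFin w) (from T-∧ (walk r , a))))))

  reach-suc⁻ : ∀ {k u v} → Reach (suc k) u v → Reach k u v ⊎ ∃ λ w → Reach k u w × Adj w v
  reach-suc⁻ {k} {u} {v} r = Data.Sum.map reached via-neighbour (to T-∨ (walk r))
    where
    via-neighbour : T (any (λ w → reach G k u w ∧ adj G w v) (allFin (n G))) →
                    ∃ λ w → Reach k u w × Adj w v
    via-neighbour r′ = let w , ra = satisfied (any⁻ _ (allFin (n G)) r′)
                       in  w , Data.Product.map₁ reached (to T-∧ ra)

  reach-mono : ∀ {k k′ u v} → k ≤ k′ → Reach k u v → Reach k′ u v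
  reach-mono k≤k′ = go (≤⇒≤′ k≤k′)
    where
    go : ∀ {k k′ u v} → k ≤′ k′ → Reach k u v → Reach k′ u v
    go (≤′-reflexive refl) r = r
    go (≤′-step k≤′k′)     r = reach-suc (go k≤′k′ r)

  reach-prepend : ∀ {k x y w} → Adj x y → Reach k y w → Reach (suc k) x w
  reach-prepend {zero} a r with reach-zero⇒≡ r
  ... | refl = reach-extend reach-zero-refl a
  reach-prepend {suc k} a r with reach-suc⁻ r
  ... | inj₁ r′           = reach-suc (reach-prepend a r′)
  ... | inj₂ (_ , r′ , a′) = reach-extend (reach-prepend a r′) a′

  reach-first-step : ∀ {k x w} → x ≢ w → Reach (suc k) x w → ∃ λ y → Adj x y × Reach k y w
  reach-first-step {zero} x≢w r with reach-suc⁻ r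
  ... | inj₁ r′ = contradiction (reach-zero⇒≡ r′) x≢w
  ... | inj₂ (_ , r′ , a′) with reach-zero⇒≡ r′
  ...   | refl = _ , a′ , reach-zero-refl
  reach-first-step {suc k} {x} x≢w r with reach-suc⁻ r
  ... | inj₁ r′ = let y , a , r″ = reach-first-step x≢w r′ in y , a , reach-suc r″
  ... | inj₂ (w′ , r′ , a′) with x ≟ w′
  ...   | yes refl = _ , a′ , reach-mono z≤n reach-zero-refl
  ...   | no  x≢w′ = let y , a , r″ = reach-first-step x≢w′ r′ in y , a , reach-extend r″ a′

  ball : ℕ → V → Subset (n G)
  ball k u = Vec.tabulate (reach G k u)

  ∈-ball⁺ : ∀ {k u v} → Reach k u v → v ∈ ball k u
  ∈-ball⁺ {k} {u} {v} r = lookup⇒[]= v _ (trans (lookup∘tabulate _ v) (to T-≡ (walk r)))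

  ∈-ball⁻ : ∀ {k u v} → v ∈ ball k u → Reach k u v
  ∈-ball⁻ {k} {u} {v} v∈ball =
    reached (from T-≡ (trans (sym (lookup∘tabulate _ v)) ([]=⇒lookup v∈ball)))

  ball-⊆-suc : ∀ {k u} → ball k u ⊆ ball (suc k) u
  ball-⊆-suc {k} {u} v∈ball = ∈-ball⁺ (reach-suc (∈-ball⁻ {k} {u} v∈ball))

  Stable : ℕ → V → Set
  Stable k u = ball (suc k) u ⊆ ball k u

  stable-suc : ∀ {k u} → Stable k u → Stable (suc k) u
  stable-suc {k} {u} stable v∈ball with reach-suc⁻ (∈-ball⁻ {suc (suc k)} {u} v∈ball)
  ... | inj₁ r           = ∈-ball⁺ r
  ... | inj₂ (_ , r , a) = ∈-ball⁺ (reach-extend (∈-ball⁻ {k} (stable (∈-ball⁺ r))) a)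

  stable-or-grows : ∀ k u → Stable k u ⊎ k < ∣ ball k u ∣
  stable-or-grows zero    u = inj₂ (≤-<-trans z≤n (x∈p⇒∣p-x∣<∣p∣ (∈-ball⁺ reach-zero-refl)))
  stable-or-grows (suc k) u with stable-or-grows k u | ball (suc k) u ⊆? ball k u
  ... | inj₁ stable | _            = inj₁ (stable-suc {k} stable)
  ... | inj₂ _      | yes stable   = inj₁ (stable-suc {k} stable)
  ... | inj₂ grows  | no  unstable =
    inj₂ (≤-<-trans grows (p⊂q⇒∣p∣<∣q∣ (ball-⊆-suc {k} {u} , ¬⊆⇒∃∈∉ unstable)))

  stable-+ : ∀ {k u} → Stable k u → ∀ i → Stable (i + k) u
  stable-+ stable zero    = stable
  stable-+ {k} stable (suc i) = stable-suc {i + k} (stable-+ stable i)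

  stable⇒ball-closed : ∀ {k u} → Stable k u → ∀ i → ball (i + k) u ⊆ ball k u
  stable⇒ball-closed stable zero    = id
  stable⇒ball-closed stable (suc i) = stable⇒ball-closed stable i ∘ stable-+ stable i

  stable-at-order : ∀ u → Stable (n G) u
  stable-at-order u with stable-or-grows (n G) u
  ... | inj₁ stable = stable
  ... | inj₂ grows  = contradiction grows (≤⇒≯ (∣p∣≤n (ball (n G) u)))

  reach-saturates : ∀ {k u v} → Reach k u v → Reach (n G) u v
  reach-saturates {k} {u} {v} r with ≤-total k (n G)
  ... | inj₁ k≤n = reach-mono k≤n r
  ... | inj₂ n≤k = ∈-ball⁻ {n G} (stable⇒ball-closed (stable-at-order u) (k ∸ n G)
                     (∈-ball⁺ (subst (λ j → Reach j u v) (sym (m∸n+n≡m n≤k)) r)))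

  search-≤ : ∀ {u v j} f k → k ≤ j → Reach j u v → dist-search G u v f k ≤ j
  search-≤ zero k k≤j r = k≤j
  search-≤ {u} {v} {j} (suc f) k k≤j r with reach G k u v in eq
  ... | true  = k≤j
  ... | false = search-≤ f (suc k) (≤∧≢⇒< k≤j k≢j) r
    where
    k≢j : k ≢ j
    k≢j refl = subst T eq (walk r)

  search-hit : ∀ {u v} f k → Reach (k + f) u v → Reach (dist-search G u v f k) u v
  search-hit {u} {v} zero k r = subst (λ j → Reach j u v) (+-identityʳ k) r
  search-hit {u} {v} (suc f) k r with reach G k u v in eq
  ... | true  = reached (from T-≡ eq)
  ... | false = search-hit f (suc k) (subst (λ j → Reach j u v) (+-suc k f) r)

  dist-≤ : ∀ {j u v} → Reach j u v → dist G u v ≤ j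
  dist-≤ = search-≤ (n G) 0 z≤n

  dist-self : ∀ {u} → dist G u u ≡ 0
  dist-self = n≤0⇒n≡0 (dist-≤ reach-zero-refl)

  costAt : Subset (n G) → (V → V) → V → ℕ
  costAt D f v = if lookup D v then dist G v (f v) else 0

  cost≡sum : ∀ D f → cost G D f ≡ sum (costAt D f)
  cost≡sum D f = trans (cong sumList (List.map-tabulate id (costAt D f))) (sum-tabulate (costAt D f))

  costAt-∈ : ∀ {D v} f → v ∈ D → costAt D f v ≡ dist G v (f v)
  costAt-∈ f v∈D rewrite []=⇒lookup v∈D = refl

  costAt-∉ : ∀ {D v} f → v ∉ D → costAt D f v ≡ 0
  costAt-∉ f v∉D rewrite ∉⇒lookup≡outside v∉D = refl

  costAt-swapped-fst : ∀ {D x} y f → x ∈ D → costAt D (f ∘ transpose x y) x ≡ dist G x (f y)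
  costAt-swapped-fst {x = x} y f x∈D =
    trans (costAt-∈ (f ∘ transpose x y) x∈D) (cong (dist G x ∘ f) (transpose-fst x y))

  costAt-swapped-snd : ∀ {D y} x f → y ∈ D → costAt D (f ∘ transpose x y) y ≡ dist G y (f x)
  costAt-swapped-snd {y = y} x f y∈D =
    trans (costAt-∈ (f ∘ transpose x y) y∈D) (cong (dist G y ∘ f) (transpose-snd x y))

  cost-transpose : ∀ D D′ {x y} f → x ≢ y → (∀ {v} → v ≢ x → v ≢ y → lookup D v ≡ lookup D′ v) →
                   let g = f ∘ transpose x y in
                   cost G D f + (costAt D′ g x + costAt D′ g y) ≡ cost G D′ g + (costAt D f x + costAt D f y)
  cost-transpose D D′ {x} {y} f x≢y agree
    rewrite cost≡sum D f | cost≡sum D′ (f ∘ transpose x y) = sum-update₂ _ _ x≢y agree-off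
    where
    agree-off : ∀ v → v ≢ x → v ≢ y → costAt D f v ≡ costAt D′ (f ∘ transpose x y) v
    agree-off v v≢x v≢y rewrite agree v≢x v≢y | transpose-other v≢x v≢y = refl

  cost-id : ∀ D → cost G D id ≡ 0
  cost-id D = trans (cost≡sum D id) (trans (sum-cong-≗ costAt-id) (sum-replicate-zero (n G)))
    where
    costAt-id : ∀ v → costAt D id v ≡ 0
    costAt-id v with lookup D v
    ... | true  = dist-self
    ... | false = refl

  BijOn-id : ∀ {D} → BijOn G D D id
  BijOn-id = (λ _ → id) , (λ _ _ _ _ → id) , (λ w w∈D → w , w∈D , refl)

  BijOn-transpose : ∀ {D₁ D₂ Dt f x y} →
                    (∀ {v} → v ∈ D₁ → transpose x y v ∈ D₂) →
                    (∀ {v} → v ∈ D₂ → transpose x y v ∈ D₁) →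
                    BijOn G D₂ Dt f → BijOn G D₁ Dt (f ∘ transpose x y)
  BijOn-transpose {f = f} {x} {y} D₁→D₂ D₂→D₁ (into , inj , onto) =
      (λ v v∈D₁ → into _ (D₁→D₂ v∈D₁))
    , (λ u v u∈D₁ v∈D₁ eq → trans (sym (transpose-involutive x y u))
          (trans (cong (transpose x y) (inj _ _ (D₁→D₂ u∈D₁) (D₁→D₂ v∈D₁) eq))
                 (transpose-involutive x y v)))
    , (λ w w∈Dt → let v , v∈D₂ , fv≡w = onto w w∈Dt
                  in transpose x y v , D₂→D₁ v∈D₂ , trans (cong f (transpose-involutive x y v)) fv≡w)

  BijOn-fixing⇒≡ : ∀ {D D′ f} → BijOn G D D′ f → (∀ {v} → v ∈ D → f v ≡ v) → D ≡ D′
  BijOn-fixing⇒≡ (into , _ , onto) fixed = ⊆-antisym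
    (λ {v} v∈D → subst (_∈ _) (fixed v∈D) (into v v∈D))
    (λ {w} w∈D′ → let v , v∈D , fv≡w = onto w w∈D′
                   in  subst (_∈ _) (trans (sym (fixed v∈D)) fv≡w) v∈D)

  module _ (connected : Connected G) where

    dist-reaches : ∀ u v → Reach (dist G u v) u v
    dist-reaches u v = let k , reachable = connected u v
                       in  search-hit (n G) 0 (reach-saturates {k} (reached (from T-≡ reachable)))

    dist≡0⇒≡ : ∀ {u v} → dist G u v ≡ 0 → u ≡ v
    dist≡0⇒≡ {u} {v} d≡0 = reach-zero⇒≡ (subst (λ j → Reach j u v) d≡0 (dist-reaches u v))

    dist-adj-≤ : ∀ {x y} w → Adj x y → dist G x w ≤ suc (dist G y w)
    dist-adj-≤ {y = y} w a = dist-≤ (reach-prepend a (dist-reaches y w))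

    dist-step : ∀ {x w} → x ≢ w → ∃ λ y → Adj x y × suc (dist G y w) ≡ dist G x w
    dist-step {x} {w} x≢w with dist G x w in eq
    ... | zero  = contradiction (dist≡0⇒≡ eq) x≢w
    ... | suc d =
      let y , a , r = reach-first-step x≢w (subst (λ j → Reach j x w) eq (dist-reaches x w))
      in  y , a , ≤-antisym (s≤s (dist-≤ r)) (subst (_≤ suc (dist G y w)) eq (dist-adj-≤ w a))

    cost≡0⇒fixed : ∀ {D f v} → cost G D f ≡ 0 → v ∈ D → f v ≡ v
    cost≡0⇒fixed {D} {f} {v} cost≡0 v∈D = sym (dist≡0⇒≡ (n≤0⇒n≡0 (begin
      dist G v (f v)    ≡⟨ costAt-∈ f v∈D ⟨
      costAt D f v      ≤⟨ ≤-sum (costAt D f) v ⟩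
      sum (costAt D f)  ≡⟨ cost≡sum D f ⟨
      cost G D f        ≡⟨ cost≡0 ⟩
      0                 ∎)))
      where open ≤-Reasoning

    Mstar-zero⇒≡ : ∀ {Ds Dt} → IsMstar G Ds Dt 0 → Ds ≡ Dt
    Mstar-zero⇒≡ ((_ , bij , cost≡0) , _) = BijOn-fixing⇒≡ bij (cost≡0⇒fixed cost≡0)

    Mstar-suc⇒unmatched : ∀ {Ds Dt m} → ∣ Ds ∣ ≡ ∣ Dt ∣ → IsMstar G Ds Dt (suc m) →
                          ∃ λ t → t ∈ Dt × t ∉ Ds
    Mstar-suc⇒unmatched {Ds} {Dt} ∣Ds∣≡∣Dt∣ (_ , optimal) with Dt ⊆? Ds
    ... | no  Dt⊈Ds = ¬⊆⇒∃∈∉ Dt⊈Ds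
    ... | yes Dt⊆Ds = contradiction (≤-trans (optimal id id-bij) (≤-reflexive (cost-id Ds))) λ ()
      where
      id-bij : BijOn G Ds Dt id
      id-bij = subst (λ D → BijOn G Ds D id) (sym (⊆∧∣≥∣⇒≡ Dt⊆Ds (≤-reflexive ∣Ds∣≡∣Dt∣)))
                     BijOn-id

    cost-slide : ∀ {D f x y} → x ∈ D → y ∉ D → Adj x y → suc (dist G y (f x)) ≡ dist G x (f x) →
                 suc (cost G (move D x y) (f ∘ transpose x y)) ≡ cost G D f
    cost-slide {D} {f} {x} {y} x∈D y∉D a closer = +-cancelʳ-≡ d _ _ (begin
      suc (cost G D′ h) + d                          ≡⟨ +-suc (cost G D′ h) d ⟨
      cost G D′ h + suc d                            ≡⟨ cong (cost G D′ h +_) (+-identityʳ (suc d)) ⟨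
      cost G D′ h + (suc d + 0)                      ≡⟨ cong₂ (λ b c → cost G D′ h + (b + c))
                                                              (trans (costAt-∈ f x∈D) (sym closer)) (costAt-∉ f y∉D) ⟨
      cost G D′ h + (costAt D f x + costAt D f y)    ≡⟨ cost-transpose D D′ f x≢y
                                                              (λ v≢x v≢y → sym (lookup-move-other D v≢x v≢y)) ⟨
      cost G D f + (costAt D′ h x + costAt D′ h y)   ≡⟨ cong₂ (λ b c → cost G D f + (b + c))
                                                              (costAt-∉ h (∉-move-source D x≢y))
                                                              (costAt-swapped-snd x f (∈-move-target D x y)) ⟩
      cost G D f + d                                 ∎)
      where
      open ≡-Reasoning
      x≢y = adj⇒≢ a
      D′ = move D x y
      h = f ∘ transpose x y
      d = dist G y (f x)

    cost-unslide-≤ : ∀ {D h x y} → x ∈ D → y ∉ D → Adj x y →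
                     cost G D (h ∘ transpose x y) ≤ suc (cost G (move D x y) h)
    cost-unslide-≤ {D} {h} {x} {y} x∈D y∉D a =
      ≤-by-exchange 1 (cost-transpose D′ D h x≢y (lookup-move-other D)) (begin
        costAt D g x + costAt D g y          ≡⟨ cong₂ _+_ (costAt-swapped-fst y h x∈D) (costAt-∉ g y∉D) ⟩
        dist G x (h y) + 0                   ≡⟨ +-identityʳ _ ⟩
        dist G x (h y)                       ≤⟨ dist-adj-≤ (h y) a ⟩
        suc (dist G y (h y))                 ≡⟨ cong₂ (λ b c → suc (b + c)) (costAt-∉ h (∉-move-source D x≢y))
                                                                         (costAt-∈ h (∈-move-target D x y)) ⟨
        1 + (costAt D′ h x + costAt D′ h y)  ∎)
      where
      open ≤-Reasoning
      x≢y = adj⇒≢ a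
      D′ = move D x y
      g = h ∘ transpose x y

    cost-swap-≤ : ∀ {D f x y} → x ∈ D → y ∈ D → Adj x y → suc (dist G y (f x)) ≡ dist G x (f x) →
                  cost G D (f ∘ transpose x y) ≤ cost G D f
    cost-swap-≤ {D} {f} {x} {y} x∈D y∈D a closer =
      ≤-by-exchange 0 (cost-transpose D D f (adj⇒≢ a) (λ _ _ → refl)) (begin
        costAt D g x + costAt D g y              ≡⟨ cong₂ _+_ (costAt-swapped-fst y f x∈D)
                                                               (costAt-swapped-snd x f y∈D) ⟩
        dist G x (f y) + dist G y (f x)          ≤⟨ +-monoˡ-≤ _ (dist-adj-≤ (f y) a) ⟩
        suc (dist G y (f y) + dist G y (f x))    ≡⟨ cong suc (+-comm (dist G y (f y)) _) ⟩
        suc (dist G y (f x)) + dist G y (f y)    ≡⟨ cong₂ _+_ (trans closer (sym (costAt-∈ f x∈D)))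
                                                               (sym (costAt-∈ f y∈D)) ⟩
        costAt D f x + costAt D f y              ∎)
      where
      open ≤-Reasoning
      g = f ∘ transpose x y

    module _ {Ds Dt : Subset (n G)} {m : ℕ} (optimal : ∀ g → BijOn G Ds Dt g → suc m ≤ cost G Ds g) where

      OptimalSlide : Set
      OptimalSlide = ∃ λ D′ → Slide G Ds D′ × IsMstar G D′ Dt m × ∣ D′ ∣ ≡ ∣ Ds ∣

      slide-to-free : ∀ {f x y} → BijOn G Ds Dt f → cost G Ds f ≡ suc m → x ∈ Ds → Adj x y → y ∉ Ds →
                      suc (dist G y (f x)) ≡ dist G x (f x) → OptimalSlide
      slide-to-free {f} {x} {y} bij cost≡ x∈Ds a y∉Ds closer =
          move Ds x y
        , (x , y , x∈Ds , y∉Ds , to T-≡ a , refl)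
        , ( ( f ∘ transpose x y
            , BijOn-transpose into-Ds into-D′ bij
            , suc-injective (trans (cost-slide x∈Ds y∉Ds a closer) cost≡))
          , λ h h-bij → ≤-pred (≤-trans (optimal _ (BijOn-transpose into-D′ into-Ds h-bij))
                                        (cost-unslide-≤ x∈Ds y∉Ds a)))
        , ∣move∣ x∈Ds y∉Ds
        where
        into-D′ = transpose-∈-move x∈Ds y∉Ds
        into-Ds = transpose-∈-unmove x∈Ds y∉Ds

      optimal-slide : ∀ d {f x} → BijOn G Ds Dt f → cost G Ds f ≡ suc m → x ∈ Ds → f x ∉ Ds →
                      dist G x (f x) ≡ d → OptimalSlide
      optimal-slide zero bij cost≡ x∈Ds fx∉Ds dist≡0 =
        contradiction (subst (_∈ Ds) (dist≡0⇒≡ dist≡0) x∈Ds) fx∉Ds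
      optimal-slide (suc d) {f} {x} bij cost≡ x∈Ds fx∉Ds dist≡
        with dist-step (λ x≡fx → fx∉Ds (subst (_∈ Ds) x≡fx x∈Ds))
      ... | y , a , closer with y ∈? Ds
      ...   | no  y∉Ds = slide-to-free bij cost≡ x∈Ds a y∉Ds closer
      ...   | yes y∈Ds = optimal-slide d g-bij g-cost y∈Ds (subst (_∉ Ds) fx≡gy fx∉Ds)
                           (trans (cong (dist G y) (sym fx≡gy)) (suc-injective (trans closer dist≡)))
        where
        g = f ∘ transpose x y
        fx≡gy : f x ≡ g y
        fx≡gy = cong f (sym (transpose-snd x y))
        g-bij : BijOn G Ds Dt g
        g-bij = BijOn-transpose within-Ds within-Ds bij
          where within-Ds = transpose-∈ (const y∈Ds) (const x∈Ds) (λ _ _ → id)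
        g-cost : cost G Ds g ≡ suc m
        g-cost = ≤-antisym (≤-trans (cost-swap-≤ x∈Ds y∈Ds a closer) (≤-reflexive cost≡)) (optimal g g-bij)

  module _ (connected : Connected G)
           (slides-preserve : ∀ D D′ → IsD2DS G D → Slide G D D′ → IsD2DS G D′) where

    Mstar⇒TSSeq : ∀ m {Ds Dt} → IsD2DS G Ds → IsD2DS G Dt → ∣ Ds ∣ ≡ ∣ Dt ∣ → IsMstar G Ds Dt m →
                  TSSeq G Ds Dt m
    Mstar⇒TSSeq zero {Ds} Ds-dom _ _ mstar =
      subst (λ D → TSSeq G Ds D 0) (Mstar-zero⇒≡ connected mstar) (done Ds-dom)
    Mstar⇒TSSeq (suc m) {Ds} {Dt} Ds-dom Dt-dom ∣Ds∣≡∣Dt∣ mstar@((f , bij , cost≡) , optimal) =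
      let t , t∈Dt , t∉Ds = Mstar-suc⇒unmatched connected ∣Ds∣≡∣Dt∣ mstar
          x , x∈Ds , fx≡t = proj₂ (proj₂ bij) t t∈Dt
          D′ , slide , mstar′ , ∣D′∣≡∣Ds∣ =
            optimal-slide connected {Ds} {Dt} optimal _ bij cost≡ x∈Ds (subst (_∉ Ds) (sym fx≡t) t∉Ds) refl
          D′-dom = slides-preserve Ds D′ Ds-dom slide
      in  step Ds-dom slide (Mstar⇒TSSeq m D′-dom Dt-dom (trans ∣D′∣≡∣Ds∣ ∣Ds∣≡∣Dt∣) mstar′)

lemma12 : (G : Graph) → Connected G → IsSplit G
    → (∀ D D' → IsD2DS G D → Slide G D D' → IsD2DS G D')
    → (Ds Dt : Subset (n G)) → IsD2DS G Ds → IsD2DS G Dt → ∣ Ds ∣ ≡ ∣ Dt ∣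
    → (m : ℕ) → IsMstar G Ds Dt m
    → TSSeq G Ds Dt m
lemma12 G connected _ slides-preserve Ds Dt Ds-dom Dt-dom ∣Ds∣≡∣Dt∣ m =
  Mstar⇒TSSeq G connected slides-preserve m Ds-dom Dt-dom ∣Ds∣≡∣Dt∣
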